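{- For the path $P_n$ of order $n\geq 2$, \[ \chi_d^t(C(P_n))=\begin{cases}\lfloor 2n/3\rfloor+2 & \text{if } n\equiv 1 \pmod 3 \text{ or } n\in\{3,5\},\\ \lfloor 2n/3\rfloor+1 & \text{otherwise}.\end{cases} \]
   Context: For a graph $G=(V,E)$ with $V=\{v_1,\dots,v_n\}$, the central graph $C(G)$ is the graph with vertex set $V\cup\{c_{ij} : v_iv_j\in E\}$ obtained by subdividing each edge $v_iv_j$ of $G$ exactly once by a new vertex $c_{ij}$ (adjacent to exactly $v_i$ and $v_j$) and joining every pair of distinct vertices non-adjacent in $G$. A total dominator coloring (TDC) of a graph $H$ with no isolated vertices is a proper vertex coloring of $H$ in which every vertex is adjacent to all vertices of some color class. $\chi_d^t(H)$ is the minimum number of color classes in a TDC of $H$. -}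

module Defs where

open import Data.Nat using (ℕ; zero; suc; _+_; _*_; _≤_)
open import Data.Nat.DivMod using (_/_; _%_)
open import Data.Fin using (Fin; toℕ) renaming (_<_ to _<ᶠ_)
open import Data.Sum using (_⊎_; inj₁; inj₂)
open import Data.Product using (Σ; _×_; _,_; ∃)
open import Data.Empty using (⊥)
open import Relation.Nullary using (¬_)
open import Relation.Binary.PropositionalEquality using (_≡_; _≢_)
open import Function.Definitions using (Surjective)

record Graph : Set₁ where
  field
    V   : Set
    Adj : V → V → Set
open Graph public

PathAdj : (n : ℕ) → Fin n → Fin n → Set
PathAdj n i j = toℕ j ≡ suc (toℕ i) ⊎ toℕ i ≡ suc (toℕ j)

Edge : (n : ℕ) → (Fin n → Fin n → Set) → Set
Edge n A = Σ (Fin n × Fin n) λ { (i , j) → (i <ᶠ j) × A i j }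

-- Central graph C(G) of a graph G on Fin n: vertices v_i (inj₁) and c_ij (inj₂)
-- for each edge v_iv_j; c_ij adjacent exactly to v_i, v_j; two original
-- vertices are adjacent iff they are distinct and non-adjacent in G.
CAdj : (n : ℕ) (A : Fin n → Fin n → Set) → (Fin n ⊎ Edge n A) → (Fin n ⊎ Edge n A) → Set
CAdj n A (inj₁ u) (inj₁ v) = (u ≢ v) × ¬ A u v
CAdj n A (inj₁ u) (inj₂ ((i , j) , _)) = (u ≡ i) ⊎ (u ≡ j)
CAdj n A (inj₂ ((i , j) , _)) (inj₁ u) = (u ≡ i) ⊎ (u ≡ j)
CAdj n A (inj₂ _) (inj₂ _) = ⊥

Central : (n : ℕ) → (Fin n → Fin n → Set) → Graph
Central n A = record { V = Fin n ⊎ Edge n A ; Adj = CAdj n A }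

-- A total dominator coloring of H with exactly k color classes:
-- a surjective map onto k colors (so every class is nonempty), proper,
-- and every vertex is adjacent to all vertices of some color class.
record IsTDC (H : Graph) (k : ℕ) (c : V H → Fin k) : Set where
  field
    onto      : Surjective _≡_ _≡_ c
    proper    : ∀ u v → Adj H u v → c u ≢ c v
    dominates : ∀ v → ∃ λ (i : Fin k) → ∀ w → c w ≡ i → Adj H v w

HasTDC : Graph → ℕ → Set
HasTDC H k = ∃ λ (c : V H → Fin k) → IsTDC H k c

TDChromaticIs : Graph → ℕ → Set
TDChromaticIs H k = HasTDC H k × (∀ k′ → HasTDC H k′ → k ≤ k′)

-- Upper bound: give v_i the colour ⌊2i/3⌋, so that the path vertices form the classes
-- {v_0,v_1}, {v_2}, {v_3,v_4}, {v_5}, …, and give all subdivision vertices one more colour.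
--
-- Lower bound: two path vertices are adjacent in C(P_n) unless they are consecutive, so a
-- colour class of path vertices is {v_i} or a "merged" pair {v_i, v_{i+1}}.  The subdivision
-- vertex of v_iv_{i+1} sees only v_i and v_{i+1}, so it dominates the class of one of them, and
-- that class contains nothing else; hence merged pairs are at least 3 apart, c merged pairs
-- satisfy 3c ≤ n + 1, and the path vertices use n − c colours.  Either some subdivision vertex
-- has a colour of its own, giving k ≥ n − c + 1, or two subdivision vertices are coloured like
-- path vertices lying away from all merged pairs, which improves the count to 3(c + 1) ≤ n + 1.
-- Both give k ≥ 2 + ⌊2(n−1)/3⌋.  For n = 3 and n = 5 a case analysis on the merged pairs
-- finds enough colours of their own to gain one more.

module Submission where

open import Defs
open import Data.Nat using (ℕ; zero; suc; _+_; _*_; _≤_; _<_; z≤n; s≤s; s≤s⁻¹; _≟_; _<?_; _≤?_; NonZero)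
open import Data.Nat.Properties
open import Data.Nat.DivMod using (_/_; _%_; m%n<n; m<n⇒m%n≡m; [m+n]%n≡m%n; +-distrib-/-∣ˡ)
open import Data.Nat.Divisibility using (divides)
open import Data.Fin using (Fin; toℕ; fromℕ<)
open import Data.Fin.Properties using (toℕ<n; toℕ-fromℕ<; toℕ-injective; injective⇒≤) renaming (_≟_ to _≟ᶠ_)
open import Data.Sum using (_⊎_; inj₁; inj₂)
open import Data.List using (List; []; _∷_; _++_; length; lookup)
open import Data.List.Properties using (length-++)
open import Data.List.Relation.Unary.All as All using (All; []; _∷_)
open import Data.List.Relation.Unary.AllPairs using ([]; _∷_)
import Data.List.Relation.Unary.AllPairs.Properties as AllPairs
open import Data.List.Relation.Unary.Unique.Propositional using (Unique)
open import Data.List.Membership.Propositional.Properties using (∈-lookup)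
open import Function.Definitions using (Injective)
open import Data.Product using (_×_; _,_; ∃; proj₁; proj₂)
open import Function using (id; _∘_)
open import Data.Empty using (⊥; ⊥-elim)
open import Data.Unit using (tt)
open import Relation.Nullary using (¬_; Dec; yes; no; ¬?)
open import Relation.Nullary.Decidable using (True; toWitness; toSum; decidable-stable; map′; _×-dec_; _⊎-dec_; _→-dec_)
open import Relation.Unary using (Decidable)
open import Relation.Binary.PropositionalEquality
open import Relation.Binary.Definitions using (tri<; tri≈; tri>)

CPath : ℕ → Graph
CPath n = Central n (PathAdj n)

PathEdge : ℕ → Set
PathEdge n = Edge n (PathAdj n)

Near : ℕ → ℕ → Set
Near i j = i ≡ j ⊎ j ≡ suc i ⊎ i ≡ suc j

near? : ∀ i j → Dec (Near i j)
near? i j = (i ≟ j) ⊎-dec (j ≟ suc i) ⊎-dec (i ≟ suc j)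

IsEnd : ℕ → ℕ → Set
IsEnd e j = j ≡ e ⊎ j ≡ suc e

isEnd? : ∀ e j → Dec (IsEnd e j)
isEnd? e j = (j ≟ e) ⊎-dec (j ≟ suc e)

Near⇒≤1+ : ∀ {i j} → Near i j → j ≤ suc i × i ≤ suc j
Near⇒≤1+ {i} (inj₁ refl) = n≤1+n i , n≤1+n i
Near⇒≤1+ {i} (inj₂ (inj₁ refl)) = ≤-refl , m≤n⇒m≤1+n (n≤1+n i)
Near⇒≤1+ {j = j} (inj₂ (inj₂ refl)) = m≤n⇒m≤1+n (n≤1+n j) , ≤-refl

¬Near-below : ∀ {i j} → 2 + j ≤ i → ¬ Near i j
¬Near-below 2+j≤i near = 1+n≰n (≤-trans 2+j≤i (proj₂ (Near⇒≤1+ near)))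

¬Near-above : ∀ {i j} → 2 + i ≤ j → ¬ Near i j
¬Near-above 2+i≤j near = 1+n≰n (≤-trans 2+i≤j (proj₁ (Near⇒≤1+ near)))

isEnd⇒≤ : ∀ {e j} → IsEnd e j → e ≤ j × j ≤ suc e
isEnd⇒≤ {e} (inj₁ refl) = ≤-refl , n≤1+n e
isEnd⇒≤ {e} (inj₂ refl) = n≤1+n e , ≤-refl

¬IsEnd-pred : ∀ i → ¬ IsEnd (suc i) i
¬IsEnd-pred i (inj₁ i≡1+i) = 1+n≰n (≤-reflexive (sym i≡1+i))
¬IsEnd-pred i (inj₂ i≡2+i) = 1+n≰n (≤-trans (n≤1+n (suc i)) (≤-reflexive (sym i≡2+i)))

¬IsEnd-+2 : ∀ i → ¬ IsEnd i (2 + i)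
¬IsEnd-+2 i (inj₁ 2+i≡i) = 1+n≰n (≤-trans (n≤1+n (suc i)) (≤-reflexive 2+i≡i))
¬IsEnd-+2 i (inj₂ 2+i≡1+i) = 1+n≰n (≤-reflexive 2+i≡1+i)

<∧≤2+⇒≡1+⊎≡2+ : ∀ {i m} → i < m → m ≤ 2 + i → m ≡ suc i ⊎ m ≡ 2 + i
<∧≤2+⇒≡1+⊎≡2+ {zero} {suc zero} _ _ = inj₁ refl
<∧≤2+⇒≡1+⊎≡2+ {zero} {suc (suc zero)} _ _ = inj₂ refl
<∧≤2+⇒≡1+⊎≡2+ {zero} {suc (suc (suc _))} _ (s≤s (s≤s ()))
<∧≤2+⇒≡1+⊎≡2+ {suc i} {suc m} (s≤s i<m) (s≤s m≤2+i) =
  Data.Sum.map (cong suc) (cong suc) (<∧≤2+⇒≡1+⊎≡2+ i<m m≤2+i)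

module _ {n : ℕ} where

  start : PathEdge n → ℕ
  start ((u , _) , _) = toℕ u

  end≡suc-start : (e : PathEdge n) → toℕ (proj₂ (proj₁ e)) ≡ suc (start e)
  end≡suc-start (_ , _ , inj₁ v≡1+u) = v≡1+u
  end≡suc-start (_ , u<v , inj₂ u≡1+v) = ⊥-elim (<-asym u<v (≤-reflexive (sym u≡1+v)))

  suc-start<n : (e : PathEdge n) → suc (start e) < n
  suc-start<n e = subst (_< n) (end≡suc-start e) (toℕ<n (proj₂ (proj₁ e)))

  start<n : (e : PathEdge n) → start e < n
  start<n e = <-trans (n<1+n (start e)) (suc-start<n e)

  edgeAt : ∀ {i} → suc i < n → PathEdge n
  edgeAt {i} 1+i<n = (fromℕ< i<n , fromℕ< 1+i<n) ,
    subst₂ _<_ (sym (toℕ-fromℕ< i<n)) (sym (toℕ-fromℕ< 1+i<n)) (n<1+n i) ,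
    inj₁ (trans (toℕ-fromℕ< 1+i<n) (cong suc (sym (toℕ-fromℕ< i<n))))
    where
    i<n : i < n
    i<n = <-trans (n<1+n i) 1+i<n

  start-edgeAt : ∀ {i} (1+i<n : suc i < n) → start (edgeAt 1+i<n) ≡ i
  start-edgeAt {i} 1+i<n = toℕ-fromℕ< (<-trans (n<1+n i) 1+i<n)

  ¬Near⇒adj : ∀ {u v : Fin n} → ¬ Near (toℕ u) (toℕ v) → Adj (CPath n) (inj₁ u) (inj₁ v)
  ¬Near⇒adj ¬near = (λ u≡v → ¬near (inj₁ (cong toℕ u≡v))) , λ uv → ¬near (inj₂ uv)

  adj⇒¬Near : ∀ {u v : Fin n} → Adj (CPath n) (inj₁ u) (inj₁ v) → ¬ Near (toℕ u) (toℕ v)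
  adj⇒¬Near (u≢v , _) (inj₁ u≡v) = u≢v (toℕ-injective u≡v)
  adj⇒¬Near (_ , ¬uv) (inj₂ uv) = ¬uv uv

  isEnd⇒adj : ∀ {u : Fin n} (e : PathEdge n) → IsEnd (start e) (toℕ u) → Adj (CPath n) (inj₂ e) (inj₁ u)
  isEnd⇒adj e (inj₁ u≡i) = inj₁ (toℕ-injective u≡i)
  isEnd⇒adj e (inj₂ u≡1+i) = inj₂ (toℕ-injective (trans u≡1+i (sym (end≡suc-start e))))

  adj⇒isEnd : ∀ {u : Fin n} (e : PathEdge n) → Adj (CPath n) (inj₂ e) (inj₁ u) → IsEnd (start e) (toℕ u)
  adj⇒isEnd e (inj₁ refl) = inj₁ refl
  adj⇒isEnd e (inj₂ refl) = inj₂ (end≡suc-start e)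

-- Upper bounds

-- Colourings of C(P_n) described on indices: v_i gets colour g i, and the
-- subdivision vertex of the edge v_e v_{e+1} gets colour h e.  The fields are
-- stated exactly in the shape produced by allUpTo?/anyUpTo?, so that for a
-- concrete n they can be checked by evaluation.
record IsPathColouring (n L : ℕ) (g h : ℕ → ℕ) : Set where
  field
    g<L : ∀ {i} → i < n → g i < L
    h<L : ∀ {e} → e < n → suc e < n → h e < L
    covers : ∀ {y} → y < L → (∃ λ i → i < n × g i ≡ y) ⊎ (∃ λ e → e < n × suc e < n × h e ≡ y)
    g-proper : ∀ {i} → i < n → ∀ {j} → j < n → g i ≡ g j → Near i j
    h-proper : ∀ {e} → e < n → suc e < n → ∀ {j} → j < n → h e ≡ g j → ¬ IsEnd e j
    vertex-dominated : ∀ {i} → i < n → ∃ λ d → d < L ×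
      (∀ {j} → j < n → g j ≡ d → ¬ Near i j) × (∀ {e} → e < n → suc e < n → h e ≡ d → IsEnd e i)
    edge-dominated : ∀ {e} → e < n → suc e < n → ∃ λ d → d < L ×
      (∀ {j} → j < n → g j ≡ d → IsEnd e j) × (∀ {e′} → e′ < n → suc e′ < n → ¬ h e′ ≡ d)

isPathColouring? : ∀ n L g h → Dec (IsPathColouring n L g h)
isPathColouring? n L g h = map′
  (λ (a , b , c , d , e , f , k) → record
    { g<L = a ; h<L = b ; covers = c ; g-proper = d ; h-proper = e ; vertex-dominated = f ; edge-dominated = k })
  -- eta-expanded, as otherwise the implicit arguments get instantiated before the tuple's type is known
  (λ C → let open IsPathColouring C in
    (λ {i} → g<L {i}) , (λ {i} → h<L {i}) , (λ {i} → covers {i}) , (λ {i} → g-proper {i}) ,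
    (λ {i} → h-proper {i}) , (λ {i} → vertex-dominated {i}) , (λ {i} → edge-dominated {i}))
  ( allUpTo? (λ i → g i <? L) n
      ×-dec allUpTo? (λ e → (suc e <? n) →-dec (h e <? L)) n
      ×-dec allUpTo? (λ y → anyUpTo? (λ i → g i ≟ y) n
              ⊎-dec anyUpTo? (λ e → (suc e <? n) ×-dec (h e ≟ y)) n) L
      ×-dec allUpTo? (λ i → allUpTo? (λ j → (g i ≟ g j) →-dec near? i j) n) n
      ×-dec allUpTo? (λ e → (suc e <? n) →-dec allUpTo? (λ j → (h e ≟ g j) →-dec ¬? (isEnd? e j)) n) n
      ×-dec allUpTo? (λ i → anyUpTo? (λ d →
              allUpTo? (λ j → (g j ≟ d) →-dec ¬? (near? i j)) n
              ×-dec allUpTo? (λ e → (suc e <? n) →-dec (h e ≟ d) →-dec isEnd? e i) n) L) n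
      ×-dec allUpTo? (λ e → (suc e <? n) →-dec anyUpTo? (λ d →
              allUpTo? (λ j → (g j ≟ d) →-dec isEnd? e j) n
              ×-dec allUpTo? (λ e′ → (suc e′ <? n) →-dec ¬? (h e′ ≟ d)) n) L) n)

module _ {n L : ℕ} {g h : ℕ → ℕ} (C : IsPathColouring n L g h) where
  open IsPathColouring C

  private
    colourℕ : V (CPath n) → ℕ
    colourℕ (inj₁ u) = g (toℕ u)
    colourℕ (inj₂ e) = h (start e)

    colourℕ<L : ∀ w → colourℕ w < L
    colourℕ<L (inj₁ u) = g<L (toℕ<n u)
    colourℕ<L (inj₂ e) = h<L (start<n e) (suc-start<n e)

    colour : V (CPath n) → Fin L
    colour w = fromℕ< (colourℕ<L w)

    toℕ-colour : ∀ w → toℕ (colour w) ≡ colourℕ w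
    toℕ-colour w = toℕ-fromℕ< (colourℕ<L w)

    colour≡⇒colourℕ≡ : ∀ w {x} → colour w ≡ x → colourℕ w ≡ toℕ x
    colour≡⇒colourℕ≡ w refl = sym (toℕ-colour w)

    onto : ∀ x → ∃ λ w → ∀ {z} → z ≡ w → colour z ≡ x
    onto x with covers (toℕ<n x)
    ... | inj₁ (i , i<n , gi≡x) = inj₁ (fromℕ< i<n) , λ { refl → toℕ-injective
      (trans (toℕ-colour (inj₁ (fromℕ< i<n))) (trans (cong g (toℕ-fromℕ< i<n)) gi≡x)) }
    ... | inj₂ (e , _ , 1+e<n , he≡x) = inj₂ (edgeAt 1+e<n) , λ { refl → toℕ-injective
      (trans (toℕ-colour (inj₂ (edgeAt 1+e<n))) (trans (cong h (start-edgeAt 1+e<n)) he≡x)) }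

    proper : ∀ w z → Adj (CPath n) w z → colour w ≢ colour z
    proper (inj₁ u) (inj₁ v) adj eq =
      adj⇒¬Near adj (g-proper (toℕ<n u) (toℕ<n v)
        (trans (colour≡⇒colourℕ≡ (inj₁ u) eq) (toℕ-colour (inj₁ v))))
    proper (inj₁ u) (inj₂ e) adj eq =
      h-proper (start<n e) (suc-start<n e) (toℕ<n u)
        (sym (trans (colour≡⇒colourℕ≡ (inj₁ u) eq) (toℕ-colour (inj₂ e)))) (adj⇒isEnd e adj)
    proper (inj₂ e) (inj₁ u) adj eq = proper (inj₁ u) (inj₂ e) adj (sym eq)

    dominates : ∀ w → ∃ λ x → ∀ z → colour z ≡ x → Adj (CPath n) w z
    dominates (inj₁ u) with vertex-dominated (toℕ<n u)
    ... | d , d<L , vertices , edges = fromℕ< d<L , dominated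
      where
      dominated : ∀ z → colour z ≡ fromℕ< d<L → Adj (CPath n) (inj₁ u) z
      dominated (inj₁ v) eq = ¬Near⇒adj (vertices (toℕ<n v)
        (trans (colour≡⇒colourℕ≡ (inj₁ v) eq) (toℕ-fromℕ< d<L)))
      dominated (inj₂ e) eq = isEnd⇒adj e (edges (start<n e) (suc-start<n e)
        (trans (colour≡⇒colourℕ≡ (inj₂ e) eq) (toℕ-fromℕ< d<L)))
    dominates (inj₂ e) with edge-dominated (start<n e) (suc-start<n e)
    ... | d , d<L , vertices , edges = fromℕ< d<L , dominated
      where
      dominated : ∀ z → colour z ≡ fromℕ< d<L → Adj (CPath n) (inj₂ e) z
      dominated (inj₁ v) eq = isEnd⇒adj e (vertices (toℕ<n v)
        (trans (colour≡⇒colourℕ≡ (inj₁ v) eq) (toℕ-fromℕ< d<L)))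
      dominated (inj₂ e′) eq = edges (start<n e′) (suc-start<n e′)
        (trans (colour≡⇒colourℕ≡ (inj₂ e′) eq) (toℕ-fromℕ< d<L))

  pathColouring⇒TDC : HasTDC (CPath n) L
  pathColouring⇒TDC = colour , record { onto = onto ; proper = proper ; dominates = dominates }

colourC2 : HasTDC (CPath 2) 2
colourC2 = pathColouring⇒TDC (toWitness {a? = isPathColouring? 2 2 g h} tt)
  where
  g h : ℕ → ℕ
  g _ = 0
  h _ = 1

colourC3 : HasTDC (CPath 3) 4
colourC3 = pathColouring⇒TDC (toWitness {a? = isPathColouring? 3 4 g h} tt)
  where
  g h : ℕ → ℕ
  g 0 = 0
  g 1 = 0
  g _ = 1
  h 0 = 2
  h _ = 3

colourC4 : HasTDC (CPath 4) 4
colourC4 = pathColouring⇒TDC (toWitness {a? = isPathColouring? 4 4 g h} tt)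
  where
  g h : ℕ → ℕ
  g 0 = 0
  g 1 = 0
  g 2 = 1
  g _ = 2
  h 2 = 3
  h _ = 2

colourC5 : HasTDC (CPath 5) 5
colourC5 = pathColouring⇒TDC (toWitness {a? = isPathColouring? 5 5 g h} tt)
  where
  g h : ℕ → ℕ
  g 0 = 0
  g 1 = 0
  g 2 = 1
  g _ = 2
  h 2 = 4
  h _ = 3

-- twoThirds i = ⌊2i/3⌋
twoThirds : ℕ → ℕ
twoThirds 0 = 0
twoThirds 1 = 0
twoThirds 2 = 1
twoThirds (suc (suc (suc i))) = 2 + twoThirds i

twoThirds-step : ∀ i → twoThirds i ≤ twoThirds (suc i) × twoThirds (suc i) ≤ suc (twoThirds i)
twoThirds-step 0 = z≤n , z≤n
twoThirds-step 1 = z≤n , s≤s z≤n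
twoThirds-step 2 = s≤s z≤n , s≤s (s≤s z≤n)
twoThirds-step (suc (suc (suc i))) with twoThirds-step i
... | up , up≤1+ = s≤s (s≤s up) , s≤s (s≤s up≤1+)

twoThirds-mono : ∀ {i j} → i ≤ j → twoThirds i ≤ twoThirds j
twoThirds-mono {j = zero} z≤n = ≤-refl
twoThirds-mono {j = suc j} i≤1+j with m≤n⇒m<n∨m≡n i≤1+j
... | inj₁ i<1+j = ≤-trans (twoThirds-mono (s≤s⁻¹ i<1+j)) (proj₁ (twoThirds-step j))
... | inj₂ refl = ≤-refl

twoThirds-+2 : ∀ i → twoThirds i < twoThirds (2 + i)
twoThirds-+2 0 = s≤s z≤n
twoThirds-+2 1 = s≤s z≤n
twoThirds-+2 2 = s≤s (s≤s z≤n)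
twoThirds-+2 (suc (suc (suc i))) = s≤s (s≤s (twoThirds-+2 i))

twoThirds≤id : ∀ i → twoThirds i ≤ i
twoThirds≤id 0 = z≤n
twoThirds≤id 1 = z≤n
twoThirds≤id 2 = s≤s z≤n
twoThirds≤id (suc (suc (suc i))) = s≤s (s≤s (m≤n⇒m≤1+n (twoThirds≤id i)))

twoThirds-onto : ∀ m {y} → y ≤ twoThirds m → ∃ λ i → i ≤ m × twoThirds i ≡ y
twoThirds-onto zero z≤n = 0 , z≤n , refl
twoThirds-onto (suc m) {y} y≤ with y ≤? twoThirds m
... | yes y≤′ = let i , i≤m , eq = twoThirds-onto m y≤′ in i , m≤n⇒m≤1+n i≤m , eq
... | no y≰ = suc m , ≤-refl , ≤-antisym (≤-trans (proj₂ (twoThirds-step m)) (≰⇒> y≰)) y≤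

twoThirds-collision : ∀ {i j} → i < j → twoThirds i ≡ twoThirds j → j ≡ suc i
twoThirds-collision {i} 1+i≤j eq with m≤n⇒m<n∨m≡n 1+i≤j
... | inj₂ 1+i≡j = sym 1+i≡j
... | inj₁ 1+i<j = ⊥-elim (<⇒≢ (≤-trans (twoThirds-+2 i) (twoThirds-mono 1+i<j)) eq)

twoThirds-fibre : ∀ i j → twoThirds i ≡ twoThirds j → Near i j
twoThirds-fibre i j eq with <-cmp i j
... | tri≈ _ i≡j _ = inj₁ i≡j
... | tri< i<j _ _ = inj₂ (inj₁ (twoThirds-collision i<j eq))
... | tri> _ _ j<i = inj₂ (inj₂ (twoThirds-collision j<i (sym eq)))

twoThirds-endClass : ∀ e → ∃ λ j → IsEnd e j × (∀ {j′} → twoThirds j′ ≡ twoThirds j → IsEnd e j′)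
twoThirds-endClass 0 = 0 , inj₁ refl , λ { {0} _ → inj₁ refl ; {1} _ → inj₂ refl ; {2} () ; {suc (suc (suc _))} () }
twoThirds-endClass 1 = 2 , inj₂ refl , λ { {0} () ; {1} () ; {2} _ → inj₂ refl ; {suc (suc (suc _))} () }
twoThirds-endClass 2 = 2 , inj₁ refl , λ { {0} () ; {1} () ; {2} _ → inj₁ refl ; {suc (suc (suc _))} () }
twoThirds-endClass (suc (suc (suc e))) with twoThirds-endClass e
... | j , end , class = 3 + j , shift end , λ
  { {0} () ; {1} () ; {2} () ; {suc (suc (suc j′))} eq → shift (class (suc-injective (suc-injective eq))) }
  where
  shift : ∀ {j} → IsEnd e j → IsEnd (3 + e) (3 + j)
  shift = Data.Sum.map (cong (3 +_)) (cong (3 +_))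

-- v_i is dominated by the class {v_0, v_1} if i ≥ 3 and by {v_5} otherwise, hence n ≥ 6.
colourCPath : ∀ m → 5 ≤ m → HasTDC (CPath (suc m)) (2 + twoThirds m)
colourCPath m 5≤m = pathColouring⇒TDC (record
  { g<L = λ i<n → s≤s (m≤n⇒m≤1+n (twoThirds-mono (s≤s⁻¹ i<n)))
  ; h<L = λ _ _ → ≤-refl
  ; covers = covers
  ; g-proper = λ {i} _ {j} _ → twoThirds-fibre i j
  ; h-proper = λ _ _ j<n eq _ → vertexColour≢edgeColour j<n (sym eq)
  ; vertex-dominated = vertex-dominated
  ; edge-dominated = λ {e} _ 1+e<n → endClass e (s≤s⁻¹ 1+e<n)
  })
  where
  L : ℕ
  L = 2 + twoThirds m

  vertexColour≢edgeColour : ∀ {j} → j < suc m → twoThirds j ≢ suc (twoThirds m)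
  vertexColour≢edgeColour j<n = <⇒≢ (s≤s (twoThirds-mono (s≤s⁻¹ j<n)))

  covers : ∀ {y} → y < L →
    (∃ λ i → i < suc m × twoThirds i ≡ y) ⊎ (∃ λ e → e < suc m × suc e < suc m × suc (twoThirds m) ≡ y)
  covers y<L with m≤n⇒m<n∨m≡n (s≤s⁻¹ y<L)
  ... | inj₁ y<1+t = let i , i≤m , eq = twoThirds-onto m (s≤s⁻¹ y<1+t) in inj₁ (i , s≤s i≤m , eq)
  ... | inj₂ y≡1+t = inj₂ (0 , s≤s z≤n , s≤s (≤-trans (s≤s z≤n) 5≤m) , sym y≡1+t)

  endClass : ∀ e → suc e ≤ m → ∃ λ d → d < L × (∀ {j} → j < suc m → twoThirds j ≡ d → IsEnd e j)
    × (∀ {e′} → e′ < suc m → suc e′ < suc m → ¬ suc (twoThirds m) ≡ d)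
  endClass e 1+e≤m with twoThirds-endClass e
  ... | j , end , class = twoThirds j , s≤s (m≤n⇒m≤1+n j-colour≤) , (λ _ → class) ,
    λ _ _ eq → <⇒≢ (s≤s j-colour≤) (sym eq)
    where
    j-colour≤ : twoThirds j ≤ twoThirds m
    j-colour≤ = twoThirds-mono (≤-trans (proj₂ (isEnd⇒≤ end)) 1+e≤m)

  dominatedBy : ∀ {i} e → suc e ≤ m → (∀ {j} → IsEnd e j → ¬ Near i j) → ∃ λ d → d < L
    × (∀ {j} → j < suc m → twoThirds j ≡ d → ¬ Near i j)
    × (∀ {e} → e < suc m → suc e < suc m → suc (twoThirds m) ≡ d → IsEnd e i)
  dominatedBy e 1+e≤m far = let d , d<L , class , noEdge = endClass e 1+e≤m in
    d , d<L , (λ j<n eq → far (class j<n eq)) , λ e<n 1+e<n eq → ⊥-elim (noEdge e<n 1+e<n eq)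

  vertex-dominated : ∀ {i} → i < suc m → ∃ λ d → d < L
    × (∀ {j} → j < suc m → twoThirds j ≡ d → ¬ Near i j)
    × (∀ {e} → e < suc m → suc e < suc m → suc (twoThirds m) ≡ d → IsEnd e i)
  vertex-dominated {i} _ with 3 ≤? i
  ... | yes 3≤i = dominatedBy 0 (≤-trans (s≤s z≤n) 5≤m)
    λ end → ¬Near-below (≤-trans (s≤s (s≤s (proj₂ (isEnd⇒≤ end)))) 3≤i)
  ... | no 3≰i = dominatedBy 4 5≤m
    λ end → ¬Near-above (≤-trans (s≤s (s≤s (≮⇒≥ 3≰i))) (proj₁ (isEnd⇒≤ end)))

-- Counting

module _ {P : ℕ → Set} (P? : Decidable P) where

  count : ℕ → ℕ
  count zero = 0
  count (suc N) with P? N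
  ... | yes _ = suc (count N)
  ... | no _ = count N

  count-yes : ∀ {N} → P N → count (suc N) ≡ suc (count N)
  count-yes {N} pN with P? N
  ... | yes _ = refl
  ... | no ¬pN = ⊥-elim (¬pN pN)

  count-no : ∀ {N} → ¬ P N → count (suc N) ≡ count N
  count-no {N} ¬pN with P? N
  ... | yes pN = ⊥-elim (¬pN pN)
  ... | no _ = refl

  count-suc : ∀ N → count N ≤ count (suc N) × count (suc N) ≤ suc (count N)
  count-suc N with P? N
  ... | yes _ = n≤1+n _ , ≤-refl
  ... | no _ = ≤-refl , n≤1+n _

  count-mono : ∀ {M N} → M ≤ N → count M ≤ count N
  count-mono {N = zero} z≤n = ≤-refl
  count-mono {N = suc N} M≤1+N with m≤n⇒m<n∨m≡n M≤1+N
  ... | inj₁ M<1+N = ≤-trans (count-mono (s≤s⁻¹ M<1+N)) (proj₁ (count-suc N))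
  ... | inj₂ refl = ≤-refl

  count-hit : ∀ {x N} → x < N → P x → suc (count x) ≤ count N
  count-hit x<N px = ≤-trans (≤-reflexive (sym (count-yes px))) (count-mono x<N)

  count-three : ∀ {x y z N} → x < y → y < z → z < N → P x → P y → P z → 3 ≤ count N
  count-three {x} {y} {z} {N} x<y y<z z<N px py pz = begin
    3             ≤⟨ s≤s (s≤s (s≤s z≤n)) ⟩
    3 + count x   ≤⟨ s≤s (s≤s (count-hit x<y px)) ⟩
    2 + count y   ≤⟨ s≤s (count-hit y<z py) ⟩
    1 + count z   ≤⟨ count-hit z<N pz ⟩
    count N       ∎
    where open ≤-Reasoning

  count-witness : ∀ N → 1 ≤ count N → ∃ λ i → i < N × P i
  count-witness (suc N) 1≤c with P? N
  ... | yes pN = N , ≤-refl , pN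
  ... | no _ = let i , i<N , pi = count-witness N 1≤c in i , m≤n⇒m≤1+n i<N , pi

  count-witness₂ : ∀ N → 2 ≤ count N → ∃ λ i → ∃ λ j → i < j × j < N × P i × P j
  count-witness₂ (suc N) 2≤c with P? N
  ... | yes pN = let i , i<N , pi = count-witness N (s≤s⁻¹ 2≤c) in i , N , i<N , ≤-refl , pi , pN
  ... | no _ = let i , j , i<j , j<N , pi , pj = count-witness₂ N 2≤c in i , j , i<j , m≤n⇒m≤1+n j<N , pi , pj

WindowsFit : (ℕ → Set) → ℕ → Set
WindowsFit P N = ∀ {i} → i < N → P i → 3 + i ≤ N

-- If no two P-points are 1 or 2 apart, every P-point i occupies the window
-- {i, i+1, i+2}; counting these windows together with the U-points outside them
-- bounds both by the number of slots.
module _ {P U : ℕ → Set} (P? : Decidable P) (U? : Decidable U)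
  (sparse₁ : ∀ {i} → P i → ¬ P (suc i)) (sparse₂ : ∀ {i} → P i → ¬ P (2 + i))
  (outside : ∀ {i} → P i → ¬ U i × ¬ U (suc i) × ¬ U (2 + i)) where

  private
    fit-skip : ∀ {N} → (∀ {i} → 3 + i ≡ suc N → ¬ P i) → WindowsFit P (suc N) → WindowsFit P N
    fit-skip last fit {i} i<N pi with m≤n⇒m<n∨m≡n (fit (m≤n⇒m≤1+n i<N) pi)
    ... | inj₁ 3+i<1+N = s≤s⁻¹ 3+i<1+N
    ... | inj₂ 3+i≡1+N = ⊥-elim (last 3+i≡1+N pi)

    fit-close : ∀ {m} → P m → WindowsFit P (3 + m) → WindowsFit P m
    fit-close {m} pm fit {i} i<m pi with 3 + i ≤? m
    ... | yes 3+i≤m = 3+i≤m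
    ... | no 3+i≰m with <∧≤2+⇒≡1+⊎≡2+ i<m (s≤s⁻¹ (≰⇒> 3+i≰m))
    ...   | inj₁ refl = ⊥-elim (sparse₁ pi pm)
    ...   | inj₂ refl = ⊥-elim (sparse₂ pi pm)

    count-skip : ∀ {N} → WindowsFit P (suc N) → count P? N * 3 + count U? N ≤ N
      → count P? (suc N) * 3 + count U? (suc N) ≤ suc N
    count-skip {N} fit bound rewrite count-no P? {N} (λ pN → 1+n≰n (≤-trans (n≤1+n (suc N)) (s≤s⁻¹ (fit ≤-refl pN)))) =
      ≤-trans (+-monoʳ-≤ (count P? N * 3) (proj₂ (count-suc U? N)))
        (≤-trans (≤-reflexive (+-suc _ _)) (s≤s bound))

    count-close : ∀ {m} → P m → count P? m * 3 + count U? m ≤ m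
      → count P? (3 + m) * 3 + count U? (3 + m) ≤ 3 + m
    count-close {m} pm bound
      rewrite count-no P? (sparse₂ pm) | count-no P? (sparse₁ pm) | count-yes P? pm
            | count-no U? (proj₂ (proj₂ (outside pm))) | count-no U? (proj₁ (proj₂ (outside pm)))
            | count-no U? (proj₁ (outside pm))
      = s≤s (s≤s (s≤s bound))

  windows : ∀ N → WindowsFit P N → count P? N * 3 + count U? N ≤ N
  windows zero _ = z≤n
  windows (suc zero) fit = count-skip fit (windows zero (fit-skip (λ ()) fit))
  windows (suc (suc zero)) fit = count-skip fit (windows (suc zero) (fit-skip (λ ()) fit))
  -- A `with` here would hide from the termination checker that both calls descend.
  windows (suc (suc (suc m))) fit = Data.Sum.[
      (λ pm → count-close pm (windows m (fit-close pm fit))) ,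
      (λ ¬pm → count-skip fit (windows (suc (suc m)) (fit-skip (λ { refl → ¬pm }) fit))) ]′ (toSum (P? m))

lookup-injective : ∀ {A : Set} {xs : List A} → Unique xs → Injective _≡_ _≡_ (lookup xs)
lookup-injective (_ ∷ _) {Fin.zero} {Fin.zero} _ = refl
lookup-injective (x≢ ∷ _) {Fin.zero} {Fin.suc j} eq = ⊥-elim (All.lookup x≢ (∈-lookup j) eq)
lookup-injective (x≢ ∷ _) {Fin.suc i} {Fin.zero} eq = ⊥-elim (All.lookup x≢ (∈-lookup i) (sym eq))
lookup-injective (_ ∷ u) {Fin.suc i} {Fin.suc j} eq = cong Fin.suc (lookup-injective u eq)

unique⇒length≤ : ∀ {k} {xs : List (Fin k)} → Unique xs → length xs ≤ k
unique⇒length≤ u = injective⇒≤ (lookup-injective u)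

-- Lower bounds

Far : ℕ → ℕ → Set
Far i j = 2 + i < j ⊎ suc j < i

far? : ∀ i j → Dec (Far i j)
far? i j = (2 + i <? j) ⊎-dec (suc j <? i)

far-or-close : ∀ i j → Far i j ⊎ j ≡ i ⊎ j ≡ suc i ⊎ j ≡ 2 + i ⊎ suc j ≡ i
far-or-close zero zero = inj₂ (inj₁ refl)
far-or-close zero (suc zero) = inj₂ (inj₂ (inj₁ refl))
far-or-close zero (suc (suc zero)) = inj₂ (inj₂ (inj₂ (inj₁ refl)))
far-or-close zero (suc (suc (suc j))) = inj₁ (inj₁ (s≤s (s≤s (s≤s z≤n))))
far-or-close (suc zero) zero = inj₂ (inj₂ (inj₂ (inj₂ refl)))
far-or-close (suc (suc i)) zero = inj₁ (inj₂ (s≤s (s≤s z≤n)))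
far-or-close (suc i) (suc j) = Data.Sum.map (Data.Sum.map s≤s s≤s)
  (Data.Sum.map (cong suc) (Data.Sum.map (cong suc) (Data.Sum.map (cong suc) (cong suc)))) (far-or-close i j)

InWindow : ℕ → ℕ → Set
InWindow i j = j ≡ i ⊎ j ≡ suc i ⊎ j ≡ 2 + i

inWindow? : ∀ i j → Dec (InWindow i j)
inWindow? i j = (j ≟ i) ⊎-dec (j ≟ suc i) ⊎-dec (j ≟ 2 + i)

outside-window : ∀ {i j} → 2 + i < j ⊎ j < i → ¬ InWindow i j
outside-window (inj₁ 2+i<j) (inj₁ refl) = <⇒≱ 2+i<j (≤-trans (n≤1+n _) (n≤1+n _))
outside-window (inj₁ 2+i<j) (inj₂ (inj₁ refl)) = <⇒≱ 2+i<j (n≤1+n _)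
outside-window (inj₁ 2+i<j) (inj₂ (inj₂ refl)) = <⇒≱ 2+i<j ≤-refl
outside-window (inj₂ j<i) (inj₁ refl) = <-irrefl refl j<i
outside-window (inj₂ j<i) (inj₂ (inj₁ refl)) = <⇒≱ j<i (n≤1+n _)
outside-window (inj₂ j<i) (inj₂ (inj₂ refl)) = <⇒≱ j<i (≤-trans (n≤1+n _) (n≤1+n _))

far⇒outside-window : ∀ {i j} → Far i j → ¬ InWindow i j × ¬ InWindow i (suc j)
far⇒outside-window (inj₁ 2+i<j) = outside-window (inj₁ 2+i<j) , outside-window (inj₁ (m<n⇒m<1+n 2+i<j))
far⇒outside-window {j = j} (inj₂ 1+j<i) = outside-window (inj₂ (<-trans (n<1+n j) 1+j<i)) , outside-window (inj₂ 1+j<i)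


module LowerBound {n k : ℕ} .{{_ : NonZero n}} {col : V (CPath n) → Fin k} (tdc : IsTDC (CPath n) k col) where
  open IsTDC tdc

  -- vertexAt j is v_j only for j < n (it is v_{j mod n} otherwise); it lets the
  -- colours of the vertices be indexed by plain numbers.
  vertexAt : ℕ → Fin n
  vertexAt j = fromℕ< (m%n<n j n)

  toℕ-vertexAt : ∀ {j} → j < n → toℕ (vertexAt j) ≡ j
  toℕ-vertexAt {j} j<n = trans (toℕ-fromℕ< (m%n<n j n)) (m<n⇒m%n≡m j<n)

  vx : ℕ → Fin k
  vx j = col (inj₁ (vertexAt j))

  col-vertex : ∀ u → col (inj₁ u) ≡ vx (toℕ u)
  col-vertex u = cong (λ v → col (inj₁ v)) (sym (toℕ-injective (toℕ-vertexAt (toℕ<n u))))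

  ex : PathEdge n → Fin k
  ex e = col (inj₂ e)

  pred< : ∀ {i} → suc i < n → i < n
  pred< {i} = <-trans (n<1+n i)

  vx-near : ∀ {i j} → i < n → j < n → vx i ≡ vx j → Near i j
  vx-near {i} {j} i<n j<n eq = decidable-stable (near? i j) λ ¬near →
    proper _ _ (¬Near⇒adj (subst₂ (λ a b → ¬ Near a b) (sym (toℕ-vertexAt i<n)) (sym (toℕ-vertexAt j<n)) ¬near))
      eq

  ex-notEnd : ∀ e {j} → j < n → vx j ≡ ex e → ¬ IsEnd (start e) j
  ex-notEnd e j<n eq end = proper _ _ (isEnd⇒adj e (subst (IsEnd (start e)) (sym (toℕ-vertexAt j<n)) end)) (sym eq)

  Pure : Fin k → Set
  Pure y = ∀ {j} → j < n → vx j ≢ y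

  pure-or-vertex : ∀ y → Pure y ⊎ ∃ λ j → j < n × vx j ≡ y
  pure-or-vertex y with anyUpTo? (λ j → vx j ≟ᶠ y) n
  ... | yes found = inj₂ found
  ... | no none = inj₁ λ j<n eq → none (_ , j<n , eq)

  -- The colour class dominated by the subdivision vertex of the edge v_i v_{i+1}.
  record EndClass (i : ℕ) : Set where
    field
      colour : Fin k
      coloured-end : vx i ≡ colour ⊎ vx (suc i) ≡ colour
      vertices-at-ends : ∀ {j} → j < n → vx j ≡ colour → IsEnd i j
      no-edge : ∀ e → ex e ≢ colour

  endClass : ∀ {i} → suc i < n → EndClass i
  endClass {i} 1+i<n with dominates (inj₂ (edgeAt 1+i<n))
  ... | d , dominated = record
    { colour = d
    ; coloured-end = coloured-end (onto d)
    ; vertices-at-ends = λ j<n eq → atEnd (subst (IsEnd (start e)) (toℕ-vertexAt j<n) (adj⇒isEnd e (dominated _ eq)))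
    ; no-edge = λ e′ eq → dominated (inj₂ e′) eq
    }
    where
    e : PathEdge n
    e = edgeAt 1+i<n
    atEnd : ∀ {j} → IsEnd (start e) j → IsEnd i j
    atEnd = subst (λ s → IsEnd s _) (start-edgeAt 1+i<n)
    coloured-end : (∃ λ w → ∀ {z} → z ≡ w → col z ≡ d) → vx i ≡ d ⊎ vx (suc i) ≡ d
    coloured-end (inj₂ e′ , member) = ⊥-elim (dominated (inj₂ e′) (member refl))
    coloured-end (inj₁ u , member) =
      Data.Sum.map (λ u≡i → subst (λ j → vx j ≡ d) u≡i u-coloured) (λ u≡1+i → subst (λ j → vx j ≡ d) u≡1+i u-coloured)
        (atEnd (adj⇒isEnd e (dominated (inj₁ u) (member refl))))
      where
      u-coloured : vx (toℕ u) ≡ d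
      u-coloured = trans (sym (col-vertex u)) (member refl)

  vertexClass : ∀ {w} → w < n →
    ∃ λ d → (∀ {j} → j < n → vx j ≡ d → ¬ Near w j) × (∀ e → ex e ≡ d → IsEnd (start e) w)
  vertexClass {w} w<n with dominates (inj₁ (vertexAt w))
  ... | d , dominated = d ,
    (λ j<n eq → subst₂ (λ a b → ¬ Near a b) (toℕ-vertexAt w<n) (toℕ-vertexAt j<n)
      (adj⇒¬Near (dominated _ eq))) ,
    λ e eq → subst (IsEnd (start e)) (toℕ-vertexAt w<n) (adj⇒isEnd e (dominated (inj₂ e) eq))

  Merged : ℕ → Set
  Merged i = suc i < n × vx i ≡ vx (suc i)

  merged? : Decidable Merged
  merged? i = (suc i <? n) ×-dec (vx i ≟ᶠ vx (suc i))

  merged-sparse₁ : ∀ {i} → Merged i → ¬ Merged (suc i)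
  merged-sparse₁ {i} (1+i<n , eq₁) (2+i<n , eq₂) =
    ¬Near-above ≤-refl (vx-near (pred< 1+i<n) 2+i<n (trans eq₁ eq₂))

  merged-sparse₂ : ∀ {i} → Merged i → ¬ Merged (2 + i)
  merged-sparse₂ {i} (1+i<n , eq₁) (3+i<n , eq₂) = excluded (endClass (pred< 3+i<n))
    where
    excluded : EndClass (suc i) → ⊥
    excluded c with EndClass.coloured-end c
    ... | inj₁ 1+i-coloured = ¬IsEnd-pred i (EndClass.vertices-at-ends c (pred< 1+i<n) (trans eq₁ 1+i-coloured))
    ... | inj₂ 2+i-coloured = ¬IsEnd-+2 (suc i) (EndClass.vertices-at-ends c 3+i<n (trans (sym eq₂) 2+i-coloured))

  merged-apart : ∀ {i j} → i < j → Merged i → Merged j → 3 + i ≤ j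
  merged-apart {i} {j} i<j mi mj with 3 + i ≤? j
  ... | yes 3+i≤j = 3+i≤j
  ... | no 3+i≰j with <∧≤2+⇒≡1+⊎≡2+ i<j (s≤s⁻¹ (≰⇒> 3+i≰j))
  ...   | inj₁ refl = ⊥-elim (merged-sparse₁ mi mj)
  ...   | inj₂ refl = ⊥-elim (merged-sparse₂ mi mj)

  merged-endClass : ∀ {i} → vx i ≡ vx (suc i) → (c : EndClass i) →
    vx i ≡ EndClass.colour c × vx (suc i) ≡ EndClass.colour c
  merged-endClass merged c with EndClass.coloured-end c
  ... | inj₁ i-coloured = i-coloured , trans (sym merged) i-coloured
  ... | inj₂ 1+i-coloured = trans merged 1+i-coloured , 1+i-coloured

  FarFromMerged : ℕ → Set
  FarFromMerged j = ∀ {i} → Merged i → Far i j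

  -- A subdivision vertex sharing its colour with v_j forces v_j away from every
  -- merged pair: otherwise the class dominated by a nearby subdivision vertex
  -- would contain that subdivision vertex or a vertex not at its ends.
  vertexColouredEdge-far : ∀ e {j} → j < n → vx j ≡ ex e → FarFromMerged j
  vertexColouredEdge-far e {j} j<n e-coloured {i} (1+i<n , merged) with far-or-close i j
  ... | inj₁ far = far
  ... | inj₂ (inj₁ refl) = ⊥-elim (EndClass.no-edge c e (trans (sym e-coloured) (proj₁ (merged-endClass merged c))))
    where
    c : EndClass i
    c = endClass 1+i<n
  ... | inj₂ (inj₂ (inj₁ refl)) =
    ⊥-elim (EndClass.no-edge c e (trans (sym e-coloured) (proj₂ (merged-endClass merged c))))
    where
    c : EndClass i
    c = endClass 1+i<n
  ... | inj₂ (inj₂ (inj₂ (inj₁ refl))) = ⊥-elim (after (endClass j<n))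
    where
    after : EndClass (suc i) → ⊥
    after c with EndClass.coloured-end c
    ... | inj₁ 1+i-coloured = ¬IsEnd-pred i (EndClass.vertices-at-ends c (pred< 1+i<n) (trans merged 1+i-coloured))
    ... | inj₂ j-coloured = EndClass.no-edge c e (trans (sym e-coloured) j-coloured)
  ... | inj₂ (inj₂ (inj₂ (inj₂ refl))) = ⊥-elim (before (endClass (pred< 1+i<n)))
    where
    before : EndClass j → ⊥
    before c with EndClass.coloured-end c
    ... | inj₁ j-coloured = EndClass.no-edge c e (trans (sym e-coloured) j-coloured)
    ... | inj₂ i-coloured = ¬IsEnd-+2 j (EndClass.vertices-at-ends c 1+i<n (trans (sym merged) i-coloured))

  vertexColouredEdge : ∀ {i} (1+i<n : suc i < n) {j} → j < n → vx j ≡ ex (edgeAt 1+i<n) →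
    FarFromMerged j × ¬ IsEnd i j
  vertexColouredEdge 1+i<n j<n eq =
    vertexColouredEdge-far e j<n eq , subst (λ s → ¬ IsEnd s _) (start-edgeAt 1+i<n) (ex-notEnd e j<n eq)
    where
    e : PathEdge n
    e = edgeAt 1+i<n

  -- One entry per colour class of vertices, taken at the last vertex of the class.
  vertexColours : ℕ → List (Fin k)
  vertexColours zero = []
  vertexColours (suc N) with merged? N
  ... | yes _ = vertexColours N
  ... | no _ = vx N ∷ vertexColours N

  length-vertexColours : ∀ N → length (vertexColours N) + count merged? N ≡ N
  length-vertexColours zero = refl
  length-vertexColours (suc N) with merged? N
  ... | yes _ = trans (+-suc _ _) (cong suc (length-vertexColours N))
  ... | no _ = cong suc (length-vertexColours N)

  all-vertexColours : ∀ {Q : Fin k → Set} N → (∀ {i} → i < N → ¬ Merged i → Q (vx i)) →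
    All Q (vertexColours N)
  all-vertexColours zero _ = []
  all-vertexColours (suc N) q with merged? N
  ... | yes _ = all-vertexColours N (λ i<N → q (m≤n⇒m≤1+n i<N))
  ... | no ¬merged = q ≤-refl ¬merged ∷ all-vertexColours N (λ i<N → q (m≤n⇒m≤1+n i<N))

  vertexColours-unique : ∀ N → N ≤ n → Unique (vertexColours N)
  vertexColours-unique zero _ = []
  vertexColours-unique (suc N) N<n with merged? N
  ... | yes _ = vertexColours-unique N (<⇒≤ N<n)
  ... | no _ = all-vertexColours N distinct ∷ vertexColours-unique N (<⇒≤ N<n)
    where
    distinct : ∀ {i} → i < N → ¬ Merged i → vx N ≢ vx i
    distinct {i} i<N ¬merged eq with vx-near N<n (<-trans i<N N<n) eq
    ... | inj₁ N≡i = <⇒≢ i<N (sym N≡i)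
    ... | inj₂ (inj₁ i≡1+N) = <⇒≱ i<N (≤-trans (n≤1+n N) (≤-reflexive (sym i≡1+N)))
    ... | inj₂ (inj₂ refl) = ¬merged (N<n , sym eq)

  pureColours-bound : ∀ {c} → count merged? n ≡ c →
    (ys : List (Fin k)) → Unique ys → All Pure ys → length ys + n ≤ k + c
  pureColours-bound refl ys ys-unique ys-pure = begin
    length ys + n                                 ≡⟨ cong (length ys +_) (sym (length-vertexColours n)) ⟩
    length ys + (length vs + count merged? n)     ≡⟨ sym (+-assoc (length ys) (length vs) _) ⟩
    (length ys + length vs) + count merged? n     ≡⟨ cong (_+ count merged? n) (sym (length-++ ys)) ⟩
    length (ys ++ vs) + count merged? n           ≤⟨ +-monoˡ-≤ (count merged? n) (unique⇒length≤ all-unique) ⟩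
    k + count merged? n                           ∎
    where
    open ≤-Reasoning
    vs : List (Fin k)
    vs = vertexColours n
    all-unique : Unique (ys ++ vs)
    all-unique = AllPairs.++⁺ ys-unique (vertexColours-unique n ≤-refl)
      (All.map (λ pure → all-vertexColours n (λ i<n _ eq → pure i<n (sym eq))) ys-pure)

  merged-fit : WindowsFit Merged (suc n)
  merged-fit _ (2+i≤n , _) = s≤s 2+i≤n

  mergedWindows : ∀ {U} (U? : Decidable U) → (∀ {i} → Merged i → ¬ U i × ¬ U (suc i) × ¬ U (2 + i))
    → count merged? n * 3 + count U? (suc n) ≤ suc n
  mergedWindows U? outside = subst (λ c → c * 3 + count U? (suc n) ≤ suc n)
    (count-no merged? (λ (n<n , _) → <-irrefl refl (pred< n<n)))
    (windows merged? U? merged-sparse₁ merged-sparse₂ outside (suc n) merged-fit)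

  mergedCount-bound : count merged? n * 3 ≤ suc n
  mergedCount-bound =
    m+n≤o⇒m≤o _ (mergedWindows {U = λ _ → ⊥} (λ _ → no λ ()) (λ _ → (λ ()) , (λ ()) , (λ ())))

  CountingBound : Set
  CountingBound = ∃ λ c → c * 3 ≤ suc n × suc n ≤ k + c

  bound-with-pure : ∀ {y} → Pure y → CountingBound
  bound-with-pure {y} pure = count merged? n , mergedCount-bound , pureColours-bound refl (y ∷ []) ([] ∷ []) (pure ∷ [])

  Uncovered : ℕ → Set
  Uncovered j = ∀ {i} → i < n → Merged i → ¬ InWindow i j

  uncovered? : Decidable Uncovered
  uncovered? j = allUpTo? (λ i → merged? i →-dec ¬? (inWindow? i j)) n

  -- Two vertex indices far from all merged pairs leave three window slots
  -- uncovered, which costs one merged pair.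
  bound-with-far : ∀ {a b} → a < b → b < n → FarFromMerged a → FarFromMerged b → CountingBound
  bound-with-far {a} {b} a<b b<n far-a far-b = suc (count merged? n) ,
    ≤-trans (≤-reflexive (+-comm 3 _))
      (≤-trans (+-monoʳ-≤ (count merged? n * 3) three-uncovered) (mergedWindows uncovered? covered)) ,
    ≤-trans (s≤s (pureColours-bound refl [] [] [])) (≤-reflexive (sym (+-suc k _)))
    where
    uncovered : ∀ {j} → FarFromMerged j → Uncovered j × Uncovered (suc j)
    uncovered far =
      (λ _ merged → proj₁ (far⇒outside-window (far merged))) , λ _ merged → proj₂ (far⇒outside-window (far merged))
    three-uncovered : 3 ≤ count uncovered? (suc n)
    three-uncovered = count-three uncovered? a<b (n<1+n b) (s≤s b<n)
      (proj₁ (uncovered far-a)) (proj₁ (uncovered far-b)) (proj₂ (uncovered far-b))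
    covered : ∀ {i} → Merged i → ¬ Uncovered i × ¬ Uncovered (suc i) × ¬ Uncovered (2 + i)
    covered {i} merged = (λ u → u i<n merged (inj₁ refl)) , (λ u → u i<n merged (inj₂ (inj₁ refl))) ,
      (λ u → u i<n merged (inj₂ (inj₂ refl)))
      where
      i<n : i < n
      i<n = pred< (proj₁ merged)

  -- The subdivision vertex of v_0v_1 has a colour used on no vertex, or the colour of some v_j
  -- (j ≥ 2).  Then the subdivision vertex of v_{j-1}v_j has a fresh colour or that of some v_{j′}
  -- with j′ ≠ j, and v_j, v_{j′} are both far from every merged pair.
  lowerBound : 1 < n → CountingBound
  lowerBound 1<n with pure-or-vertex (ex (edgeAt 1<n))
  ... | inj₁ pure = bound-with-pure pure
  ... | inj₂ (j₁ , j₁<n , eq₁) with vertexColouredEdge 1<n j₁<n eq₁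
  ...   | far₁ , notEnd₁ = secondEdge j₁ j₁<n far₁ notEnd₁
    where
    secondEdge : ∀ j₁ → j₁ < n → FarFromMerged j₁ → ¬ IsEnd 0 j₁ → CountingBound
    secondEdge zero _ _ notEnd = ⊥-elim (notEnd (inj₁ refl))
    secondEdge (suc zero) _ _ notEnd = ⊥-elim (notEnd (inj₂ refl))
    secondEdge (suc (suc j)) j₁<n far₁ _ with pure-or-vertex (ex (edgeAt j₁<n))
    ... | inj₁ pure = bound-with-pure pure
    ... | inj₂ (j₂ , j₂<n , eq₂) with vertexColouredEdge j₁<n j₂<n eq₂ | <-cmp (suc (suc j)) j₂
    ...   | far₂ , _ | tri< j₁<j₂ _ _ = bound-with-far j₁<j₂ j₂<n far₁ far₂
    ...   | far₂ , _ | tri> _ _ j₂<j₁ = bound-with-far j₂<j₁ j₁<n far₂ far₁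
    ...   | _ , notEnd₂ | tri≈ _ refl _ = ⊥-elim (notEnd₂ (inj₂ refl))

  pureEdge : ∀ {e} (1+e<n : suc e < n) → (∀ {j} → j < n → FarFromMerged j → IsEnd e j) → Pure (ex (edgeAt 1+e<n))
  pureEdge 1+e<n ends j<n eq = let far , notEnd = vertexColouredEdge 1+e<n j<n eq in notEnd (ends j<n far)

  ColoursNear : ℕ → Set
  ColoursNear w = ∀ {j} → j < n → Near w j ⊎ ∃ λ j′ → j′ < n × Near w j′ × vx j′ ≡ vx j

  pureClass : ∀ {w} → w < n → ColoursNear w → ∃ λ d → Pure d × (∀ e → ex e ≡ d → IsEnd (start e) w)
  pureClass w<n covered with vertexClass w<n
  ... | d , notNear , edges = d , pure , edges
    where
    pure : Pure d
    pure j<n eq with covered j<n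
    ... | inj₁ near = notNear j<n eq near
    ... | inj₂ (j′ , j′<n , near , same) = notNear j′<n (trans same eq) near

  twoPureColours : ∀ {c w e} → count merged? n ≡ c → w < n → (1+e<n : suc e < n) → ¬ IsEnd e w → ColoursNear w
    → (∀ {j} → j < n → FarFromMerged j → IsEnd e j) → 2 + n ≤ k + c
  twoPureColours c≡ w<n 1+e<n ¬end covered ends with pureClass w<n covered
  ... | d , d-pure , d-edges =
    pureColours-bound c≡ (y ∷ d ∷ []) ((y≢d ∷ []) ∷ [] ∷ []) (pureEdge 1+e<n ends ∷ d-pure ∷ [])
    where
    y : Fin k
    y = ex (edgeAt 1+e<n)
    y≢d : y ≢ d
    y≢d eq = ¬end (subst (λ s → IsEnd s _) (start-edgeAt 1+e<n) (d-edges _ eq))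

twoThirds+c≤ : ∀ m c → c * 3 ≤ 2 + m → twoThirds m + c ≤ m
twoThirds+c≤ m zero _ = ≤-trans (≤-reflexive (+-identityʳ _)) (twoThirds≤id m)
twoThirds+c≤ 0 (suc c) (s≤s (s≤s ()))
twoThirds+c≤ 1 (suc zero) _ = ≤-refl
twoThirds+c≤ 1 (suc (suc c)) (s≤s (s≤s (s≤s ())))
twoThirds+c≤ 2 (suc zero) _ = ≤-refl
twoThirds+c≤ 2 (suc (suc c)) (s≤s (s≤s (s≤s (s≤s ()))))
twoThirds+c≤ (suc (suc (suc m))) (suc c) (s≤s (s≤s (s≤s c*3≤2+m))) =
  ≤-trans (≤-reflexive (cong (2 +_) (+-suc (twoThirds m) c))) (s≤s (s≤s (s≤s (twoThirds+c≤ m c c*3≤2+m))))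

lower-CPath : ∀ m {k} → 1 ≤ m → HasTDC (CPath (suc m)) k → 2 + twoThirds m ≤ k
lower-CPath m {k} 1≤m (_ , tdc) = let c , c*3≤2+m , 2+m≤k+c = lowerBound (s≤s 1≤m) in
  +-cancelʳ-≤ c (2 + twoThirds m) k (≤-trans (s≤s (s≤s (twoThirds+c≤ m c c*3≤2+m))) 2+m≤k+c)
  where open LowerBound tdc

checkBelow : ∀ n {P : ℕ → Set} (P? : Decidable P) → True (allUpTo? P? n) → ∀ {j} → j < n → P j
checkBelow n P? = toWitness

lower-C3 : ∀ {k} → HasTDC (CPath 3) k → 4 ≤ k
lower-C3 {k} (_ , tdc) = byMergedCount (count merged? 3) refl
  where
  open LowerBound tdc

  allNear1 : ColoursNear 1
  allNear1 {0} _ = inj₁ (inj₂ (inj₂ refl))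
  allNear1 {1} _ = inj₁ (inj₁ refl)
  allNear1 {2} _ = inj₁ (inj₂ (inj₁ refl))
  allNear1 {suc (suc (suc _))} (s≤s (s≤s (s≤s ())))

  byMergedCount : ∀ c → count merged? 3 ≡ c → 4 ≤ k
  byMergedCount zero c≡0 with pureClass {1} (s≤s (s≤s z≤n)) allNear1
  ... | d , pure , _ = +-cancelʳ-≤ 0 4 k (pureColours-bound c≡0 (d ∷ []) ([] ∷ []) (pure ∷ []))
  byMergedCount (suc zero) c≡1 with count-witness merged? 3 (≤-reflexive (sym c≡1))
  ... | 0 , _ , merged = +-cancelʳ-≤ 1 4 k (twoPureColours {w = 2} {e = 0} c≡1 ≤-refl (s≤s (s≤s z≤n))
    (λ { (inj₁ ()) ; (inj₂ ()) }) covered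
    λ j<3 far → ⊥-elim (checkBelow 3 (λ j → ¬? (far? 0 j)) tt j<3 (far merged)))
    where
    covered : ColoursNear 2
    covered {0} _ = inj₂ (1 , s≤s (s≤s z≤n) , inj₂ (inj₂ refl) , sym (proj₂ merged))
    covered {1} _ = inj₁ (inj₂ (inj₂ refl))
    covered {2} _ = inj₁ (inj₁ refl)
    covered {suc (suc (suc _))} (s≤s (s≤s (s≤s ())))
  ... | 1 , _ , merged = +-cancelʳ-≤ 1 4 k (twoPureColours {w = 0} {e = 1} c≡1 (s≤s z≤n) ≤-refl
    (λ { (inj₁ ()) ; (inj₂ ()) }) covered
    λ j<3 far → ⊥-elim (checkBelow 3 (λ j → ¬? (far? 1 j)) tt j<3 (far merged)))
    where
    covered : ColoursNear 0
    covered {0} _ = inj₁ (inj₁ refl)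
    covered {1} _ = inj₁ (inj₂ (inj₁ refl))
    covered {2} _ = inj₂ (1 , s≤s (s≤s z≤n) , inj₂ (inj₁ refl) , proj₂ merged)
    covered {suc (suc (suc _))} (s≤s (s≤s (s≤s ())))
  ... | suc (suc _) , _ , (s≤s (s≤s (s≤s ())) , _)
  byMergedCount (suc (suc c)) c≡ with subst (λ c → c * 3 ≤ 4) c≡ mergedCount-bound
  ... | s≤s (s≤s (s≤s (s≤s ())))

mergedPair-in-C5 : ∀ {i j} → 3 + i ≤ j → suc j < 5 → i ≡ 0 × j ≡ 3
mergedPair-in-C5 {i} {j} 3+i≤j 1+j<5 =
  n≤0⇒n≡0 (s≤s⁻¹ (s≤s⁻¹ (s≤s⁻¹ (≤-trans 3+i≤j j≤3)))) , ≤-antisym j≤3 (≤-trans (m≤m+n 3 i) 3+i≤j)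
  where
  j≤3 : j ≤ 3
  j≤3 = s≤s⁻¹ (s≤s⁻¹ 1+j<5)

lower-C5 : ∀ {k} → HasTDC (CPath 5) k → 5 ≤ k
lower-C5 {k} (_ , tdc) = byMergedCount (count merged? 5) refl
  where
  open LowerBound tdc

  onePure : ∀ {e} → count merged? 5 ≡ 1 → (1+e<5 : suc e < 5) →
    (∀ {j} → j < 5 → FarFromMerged j → IsEnd e j) → 5 ≤ k
  onePure c≡1 1+e<5 ends = +-cancelʳ-≤ 1 5 k (pureColours-bound c≡1 (_ ∷ []) ([] ∷ []) (pureEdge 1+e<5 ends ∷ []))

  farEnds : ∀ i e → Merged i → True (allUpTo? (λ j → far? i j →-dec isEnd? e j) 5) →
    ∀ {j} → j < 5 → FarFromMerged j → IsEnd e j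
  farEnds i e merged check j<5 far = checkBelow 5 (λ j → far? i j →-dec isEnd? e j) check j<5 (far merged)

  byMergedCount : ∀ c → count merged? 5 ≡ c → 5 ≤ k
  byMergedCount zero c≡0 = +-cancelʳ-≤ 0 5 k (pureColours-bound c≡0 [] [] [])
  byMergedCount (suc zero) c≡1 with count-witness merged? 5 (≤-reflexive (sym c≡1))
  ... | 0 , _ , merged = onePure {3} c≡1 ≤-refl (farEnds 0 3 merged tt)
  ... | 1 , _ , merged = onePure {3} c≡1 ≤-refl (farEnds 1 3 merged tt)
  ... | 2 , _ , merged = onePure {0} c≡1 (s≤s (s≤s z≤n)) (farEnds 2 0 merged tt)
  ... | 3 , _ , merged = onePure {0} c≡1 (s≤s (s≤s z≤n)) (farEnds 3 0 merged tt)
  ... | suc (suc (suc (suc _))) , _ , (s≤s (s≤s (s≤s (s≤s (s≤s ())))) , _)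
  byMergedCount (suc (suc zero)) c≡2 with count-witness₂ merged? 5 (≤-reflexive (sym c≡2))
  ... | i , j , i<j , _ , mᵢ , mⱼ with mergedPair-in-C5 (merged-apart i<j mᵢ mⱼ) (proj₁ mⱼ)
  ...   | refl , refl = +-cancelʳ-≤ 2 5 k
    (twoPureColours {w = 2} {e = 0} c≡2 (s≤s (s≤s (s≤s z≤n))) (s≤s (s≤s z≤n))
    (λ { (inj₁ ()) ; (inj₂ ()) }) covered
    λ j<5 far → ⊥-elim (checkBelow 5 (λ j → ¬? (far? 0 j ×-dec far? 3 j)) tt j<5 (far mᵢ , far mⱼ)))
    where
    covered : ColoursNear 2
    covered {0} _ = inj₂ (1 , s≤s (s≤s z≤n) , inj₂ (inj₂ refl) , sym (proj₂ mᵢ))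
    covered {1} _ = inj₁ (inj₂ (inj₂ refl))
    covered {2} _ = inj₁ (inj₁ refl)
    covered {3} _ = inj₁ (inj₂ (inj₁ refl))
    covered {4} _ = inj₂ (3 , s≤s (s≤s (s≤s (s≤s z≤n))) , inj₂ (inj₁ refl) , proj₂ mⱼ)
    covered {suc (suc (suc (suc (suc _))))} (s≤s (s≤s (s≤s (s≤s (s≤s ())))))
  byMergedCount (suc (suc (suc c))) c≡ with subst (λ c → c * 3 ≤ 6) c≡ mergedCount-bound
  ... | s≤s (s≤s (s≤s (s≤s (s≤s (s≤s ())))))

upper-CPath : ∀ m → 1 ≤ m → suc m ≢ 3 → suc m ≢ 5 → HasTDC (CPath (suc m)) (2 + twoThirds m)
upper-CPath 1 _ _ _ = colourC2
upper-CPath 2 _ ≢3 _ = ⊥-elim (≢3 refl)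
upper-CPath 3 _ _ _ = colourC4
upper-CPath 4 _ _ ≢5 = ⊥-elim (≢5 refl)
upper-CPath (suc (suc (suc (suc (suc m))))) _ _ _ = colourCPath _ (s≤s (s≤s (s≤s (s≤s (s≤s z≤n)))))

χ-CPath : ∀ m → 1 ≤ m → suc m ≢ 3 → suc m ≢ 5 → TDChromaticIs (CPath (suc m)) (2 + twoThirds m)
χ-CPath m 1≤m ≢3 ≢5 = upper-CPath m 1≤m ≢3 ≢5 , λ _ → lower-CPath m 1≤m

χ-C3 : TDChromaticIs (CPath 3) 4
χ-C3 = colourC3 , λ _ → lower-C3

χ-C5 : TDChromaticIs (CPath 5) 5
χ-C5 = colourC5 , λ _ → lower-C5

⌊2n/3⌋-step : ∀ m → (2 * (3 + m)) / 3 ≡ 2 + (2 * m) / 3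
⌊2n/3⌋-step m = trans (cong (_/ 3) (*-distribˡ-+ 2 3 m)) (+-distrib-/-∣ˡ (2 * m) {3} (divides 2 refl))

%3-step : ∀ m → (3 + m) % 3 ≡ m % 3
%3-step m = trans (cong (_% 3) (+-comm 3 m)) ([m+n]%n≡m%n m 3)

chromatic-≡1 : ∀ m → suc m % 3 ≡ 1 → (2 * suc m) / 3 + 2 ≡ 2 + twoThirds m
chromatic-≡1 0 _ = refl
chromatic-≡1 1 ()
chromatic-≡1 2 ()
chromatic-≡1 (suc (suc (suc m))) r =
  trans (cong (_+ 2) (⌊2n/3⌋-step (suc m))) (cong (2 +_) (chromatic-≡1 m (trans (sym (%3-step (suc m))) r)))

chromatic-≢1 : ∀ m → suc m % 3 ≢ 1 → (2 * suc m) / 3 + 1 ≡ 2 + twoThirds m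
chromatic-≢1 0 r = ⊥-elim (r refl)
chromatic-≢1 1 _ = refl
chromatic-≢1 2 _ = refl
chromatic-≢1 (suc (suc (suc m))) r =
  trans (cong (_+ 1) (⌊2n/3⌋-step (suc m))) (cong (2 +_) (chromatic-≢1 m (r ∘ trans (%3-step (suc m)))))

proposition5p1 : (n : ℕ) → 2 ≤ n →
    ((n % 3 ≡ 1 ⊎ n ≡ 3 ⊎ n ≡ 5) → TDChromaticIs (Central n (PathAdj n)) ((2 * n) / 3 + 2))
    × (¬ (n % 3 ≡ 1 ⊎ n ≡ 3 ⊎ n ≡ 5) → TDChromaticIs (Central n (PathAdj n)) ((2 * n) / 3 + 1))
proposition5p1 (suc m) (s≤s 1≤m) with suc m ≟ 3 | suc m ≟ 5
... | yes refl | _ = (λ _ → χ-C3) , λ regular → ⊥-elim (regular (inj₂ (inj₁ refl)))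
... | no _ | yes refl = (λ _ → χ-C5) , λ regular → ⊥-elim (regular (inj₂ (inj₂ refl)))
... | no ≢3 | no ≢5 =
  (λ exceptional → subst (TDChromaticIs (CPath (suc m))) (sym (chromatic-≡1 m (residue exceptional))) χ) ,
  λ regular → subst (TDChromaticIs (CPath (suc m))) (sym (chromatic-≢1 m (regular ∘ inj₁))) χ
  where
  χ : TDChromaticIs (CPath (suc m)) (2 + twoThirds m)
  χ = χ-CPath m 1≤m ≢3 ≢5
  residue : suc m % 3 ≡ 1 ⊎ suc m ≡ 3 ⊎ suc m ≡ 5 → suc m % 3 ≡ 1
  residue = Data.Sum.[ id , Data.Sum.[ ⊥-elim ∘ ≢3 , ⊥-elim ∘ ≢5 ]′ ]′
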